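{- Let $n\ge 1$ and $X=(x_1,\dots,x_n),Y=(y_1,\dots,y_n)\in\{0,1\}^n$. For $l\in\{0,1,\dots,n-1\}$ let $F^{(l)}(X,Y)=\sum_{i=l+1}^n 2^{i-l-1}(x_i-y_i)$, and let $F(X,Y)=F^{(0)}(X,Y)$. Then \[ F(X,Y)>0 \iff \exists\, l\in\{0,\dots,n-1\}: F^{(l)}(X,Y)=1, \] \[ F(X,Y)<0 \iff \exists\, l\in\{0,\dots,n-1\}: F^{(l)}(X,Y)=-1. \] -}

module Defs where

open import Data.Bool using (Bool; true; false)
open import Data.Nat as ℕ using (ℕ; zero; suc; _∸_; _≤?_)
open import Data.Fin using (Fin; toℕ)
open import Data.Integer using (ℤ; +_; _+_; _-_; _*_; 0ℤ)
open import Data.Vec.Functional using (Vector; foldr)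
open import Relation.Nullary.Decidable using (does)

bit : Bool → ℤ
bit true  = + 1
bit false = + 0

Σℤ : ∀ {n} → Vector ℤ n → ℤ
Σℤ = foldr _+_ 0ℤ

-- Paper index i ∈ {1,…,n} corresponds to i' : Fin n with i = toℕ i' + 1.
-- F^(l)(X,Y) = Σ_{i=l+1}^n 2^(i-l-1) (x_i - y_i)
--            = Σ_{i' : Fin n, toℕ i' ≥ l} 2^(toℕ i' - l) (x_{i'} - y_{i'}).
F^ : ∀ {n} → ℕ → Vector Bool n → Vector Bool n → ℤ
F^ l X Y = Σℤ (λ i → term i (does (l ≤? toℕ i)))
  where
  term : _ → Bool → ℤ
  term i true  = (+ (2 ℕ.^ (toℕ i ∸ l))) * (bit (X i) - bit (Y i))
  term i false = 0ℤ

F : ∀ {n} → Vector Bool n → Vector Bool n → ℤ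
F = F^ 0

{-# OPTIONS --safe #-}

-- Write F^(l) = d_{l+1} + 2 F^(l+1), where d_i = x_i - y_i ∈ {-1, 0, 1}.
-- If F^(l) > 0 then either F^(l) = 1, or F^(l+1) ≥ 1 (since F^(l+1) ≤ 0 would
-- force F^(l) ≤ d_{l+1} ≤ 1); conversely F^(l+1) ≥ 1 gives F^(l) ≥ -1 + 2 > 0.
-- Descending through l proves the first equivalence; the second follows by
-- exchanging X and Y, which negates every F^(l).
module Submission where

open import Defs
open import Data.Bool using (Bool; true; false)
open import Data.Nat as ℕ using (ℕ; zero; suc; _≥_; _<_; _≤?_; z≤n; s≤s)
import Data.Nat.Properties as ℕ
open import Data.Fin using (Fin; toℕ) renaming (zero to fzero; suc to fsuc)
open import Data.Integer
  using (ℤ; +_; -_; 0ℤ; +[1+_]; -[1+_]; _+_; _-_; _*_; +<+)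
  renaming (_<_ to _<ℤ_)
open import Data.Integer.Properties
  using ( *-zeroʳ; *-distribˡ-+; *-assoc; *-identityˡ; +-identityˡ; pos-*
        ; neg-distrib-+; neg-distribʳ-*; neg-injective; neg-mono-<; neg-cancel-<)
open import Data.Vec.Functional using (Vector; head; tail)
open import Data.Product using (Σ; proj₁; _×_; _,_; ∃-syntax; map₂)
open import Data.Sum using (_⊎_; inj₁; inj₂)
open import Function.Bundles using (_⇔_; mk⇔; module Equivalence)
open import Function.Properties.Equivalence using () renaming (trans to ⇔-trans)
open import Relation.Nullary.Decidable using (does)
open import Relation.Binary.PropositionalEquality
  using (_≡_; refl; sym; trans; cong; cong₂; subst; module ≡-Reasoning)

Σℤ-cong : ∀ {n} {f g : Vector ℤ n} → (∀ i → f i ≡ g i) → Σℤ f ≡ Σℤ g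
Σℤ-cong {zero}  f≡g = refl
Σℤ-cong {suc n} f≡g = cong₂ _+_ (f≡g fzero) (Σℤ-cong (λ i → f≡g (fsuc i)))

Σℤ-*ˡ : ∀ {n} c (f : Vector ℤ n) → Σℤ (λ i → c * f i) ≡ c * Σℤ f
Σℤ-*ˡ {zero}  c f = sym (*-zeroʳ c)
Σℤ-*ˡ {suc n} c f = trans (cong (_+_ (c * head f)) (Σℤ-*ˡ c (tail f)))
                          (sym (*-distribˡ-+ c (head f) (Σℤ (tail f))))

Σℤ-neg : ∀ {n} (f : Vector ℤ n) → Σℤ (λ i → - f i) ≡ - Σℤ f
Σℤ-neg {zero}  f = refl
Σℤ-neg {suc n} f = trans (cong (_+_ (- head f)) (Σℤ-neg (tail f)))
                         (sym (neg-distrib-+ (head f) (Σℤ (tail f))))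

digit : Bool → Bool → ℤ
digit x y = bit x - bit y

digit-swap : ∀ x y → digit y x ≡ - digit x y
digit-swap false false = refl
digit-swap false true  = refl
digit-swap true  false = refl
digit-swap true  true  = refl

-- The summand of F^ is local to its definition; unification names it.
F^-as-Σℤ : ∀ {n} l (X Y : Vector Bool n) → Σ (Vector ℤ n) (λ f → F^ l X Y ≡ Σℤ f)
F^-as-Σℤ l X Y = _ , refl

summand : ∀ {n} → ℕ → Vector Bool n → Vector Bool n → Vector ℤ n
summand l X Y = proj₁ (F^-as-Σℤ l X Y)

summand-swap : ∀ {n} l (X Y : Vector Bool n) i → summand l Y X i ≡ - summand l X Y i
summand-swap l X Y i with does (l ≤? toℕ i)
... | true  = trans (cong (+ (2 ℕ.^ (toℕ i ℕ.∸ l)) *_) (digit-swap (X i) (Y i)))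
                    (sym (neg-distribʳ-* (+ (2 ℕ.^ (toℕ i ℕ.∸ l))) (digit (X i) (Y i))))
... | false = refl

F^-swap : ∀ {n} l (X Y : Vector Bool n) → F^ l Y X ≡ - F^ l X Y
F^-swap l X Y = trans (Σℤ-cong (summand-swap l X Y)) (Σℤ-neg (summand l X Y))

does-s≤?s : ∀ l m → does (suc l ≤? suc m) ≡ does (l ≤? m)
does-s≤?s zero    m = refl
does-s≤?s (suc l) m = refl

summand-suc : ∀ {n} l (X Y : Vector Bool (suc n)) i →
              summand (suc l) X Y (fsuc i) ≡ summand l (tail X) (tail Y) i
summand-suc l X Y i rewrite does-s≤?s l (toℕ i) with does (l ≤? toℕ i)
... | true  = refl
... | false = refl

F^-suc : ∀ {n} l (X Y : Vector Bool (suc n)) → F^ (suc l) X Y ≡ F^ l (tail X) (tail Y)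
F^-suc l X Y = trans (+-identityˡ _) (Σℤ-cong (summand-suc l X Y))

F-unfold : ∀ {n} (X Y : Vector Bool (suc n)) →
           F X Y ≡ digit (head X) (head Y) + + 2 * F (tail X) (tail Y)
F-unfold {n} X Y = cong₂ _+_ (*-identityˡ (digit (head X) (head Y))) (begin
  Σℤ (λ i → + (2 ℕ.^ suc (toℕ i)) * d i)  ≡⟨ Σℤ-cong doubled ⟩
  Σℤ (λ i → + 2 * summand 0 X′ Y′ i)      ≡⟨ Σℤ-*ˡ (+ 2) (summand 0 X′ Y′) ⟩
  + 2 * F X′ Y′                           ∎)
  where
  open ≡-Reasoning
  X′ Y′ : Vector Bool n
  X′ = tail X
  Y′ = tail Y
  d : Fin n → ℤ
  d i = digit (X′ i) (Y′ i)
  doubled : ∀ i → + (2 ℕ.^ suc (toℕ i)) * d i ≡ + 2 * summand 0 X′ Y′ i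
  doubled i = trans (cong (_* d i) (pos-* 2 (2 ℕ.^ toℕ i))) (*-assoc (+ 2) (+ (2 ℕ.^ toℕ i)) (d i))

-- Normal forms of 2 * (1 + k), so that rewriting exposes the constructors.
double-suc : ∀ k → k ℕ.+ suc (k ℕ.+ 0) ≡ suc (k ℕ.+ k)
double-suc k = trans (ℕ.+-suc k (k ℕ.+ 0)) (cong (λ m → suc (k ℕ.+ m)) (ℕ.+-identityʳ k))

double-pos : ∀ k → + 2 * +[1+ k ] ≡ +[1+ suc (k ℕ.+ k) ]
double-pos k = cong (λ m → + suc m) (double-suc k)

double-neg : ∀ k → + 2 * -[1+ k ] ≡ -[1+ suc (k ℕ.+ k) ]
double-neg k = cong -[1+_] (double-suc k)

digit+2*-pos⇒ : ∀ x y T → 0ℤ <ℤ digit x y + + 2 * T →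
                digit x y + + 2 * T ≡ + 1 ⊎ 0ℤ <ℤ T
digit+2*-pos⇒ x     y     +[1+ k ] _ = inj₂ (+<+ (s≤s z≤n))
digit+2*-pos⇒ true  false (+ 0) _ = inj₁ refl
digit+2*-pos⇒ true  true  (+ 0) (+<+ ())
digit+2*-pos⇒ false false (+ 0) (+<+ ())
digit+2*-pos⇒ false true  (+ 0) ()
digit+2*-pos⇒ x     y     -[1+ k ] p rewrite double-neg k with x | y | p
... | true  | true  | ()
... | true  | false | ()
... | false | true  | ()
... | false | false | ()

digit+2*-pos⇐ : ∀ x y T → 0ℤ <ℤ T → 0ℤ <ℤ digit x y + + 2 * T
digit+2*-pos⇐ x y (+ 0) (+<+ ())
digit+2*-pos⇐ x y +[1+ k ] _ rewrite double-pos k with x | y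
... | true  | true  = +<+ (s≤s z≤n)
... | true  | false = +<+ (s≤s z≤n)
... | false | true  = +<+ (s≤s z≤n)
... | false | false = +<+ (s≤s z≤n)

F-pos⇒F^≡1 : ∀ {n} (X Y : Vector Bool n) → 0ℤ <ℤ F X Y → ∃[ l ] (l < n × F^ l X Y ≡ + 1)
F-pos⇒F^≡1 {zero}  X Y (+<+ ())
F-pos⇒F^≡1 {suc n} X Y F>0
  with digit+2*-pos⇒ (head X) (head Y) (F (tail X) (tail Y)) (subst (0ℤ <ℤ_) (F-unfold X Y) F>0)
... | inj₁ F≡1 = 0 , s≤s z≤n , trans (F-unfold X Y) F≡1
... | inj₂ F′>0 with F-pos⇒F^≡1 (tail X) (tail Y) F′>0
...   | l , l<n , F^≡1 = suc l , s≤s l<n , trans (F^-suc l X Y) F^≡1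

F^≡1⇒F-pos : ∀ {n} (X Y : Vector Bool n) → ∃[ l ] (l < n × F^ l X Y ≡ + 1) → 0ℤ <ℤ F X Y
F^≡1⇒F-pos {suc n} X Y (zero , _ , F≡1) = subst (0ℤ <ℤ_) (sym F≡1) (+<+ (s≤s z≤n))
F^≡1⇒F-pos {suc n} X Y (suc l , s≤s l<n , F^≡1) =
  subst (0ℤ <ℤ_) (sym (F-unfold X Y))
    (digit+2*-pos⇐ (head X) (head Y) _
      (F^≡1⇒F-pos (tail X) (tail Y) (l , l<n , trans (sym (F^-suc l X Y)) F^≡1)))

F-pos⇔ : ∀ {n} (X Y : Vector Bool n) → (0ℤ <ℤ F X Y) ⇔ (∃[ l ] (l < n × F^ l X Y ≡ + 1))
F-pos⇔ X Y = mk⇔ (F-pos⇒F^≡1 X Y) (F^≡1⇒F-pos X Y)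

F<0⇔F-swap>0 : ∀ {n} (X Y : Vector Bool n) → (F X Y <ℤ 0ℤ) ⇔ (0ℤ <ℤ F Y X)
F<0⇔F-swap>0 X Y = mk⇔
  (λ F<0 → subst (0ℤ <ℤ_) (sym (F^-swap 0 X Y)) (neg-mono-< F<0))
  (λ F′>0 → neg-cancel-< (subst (0ℤ <ℤ_) (F^-swap 0 X Y) F′>0))

F^-swap≡1⇔F^≡-1 : ∀ {n} l (X Y : Vector Bool n) → (F^ l Y X ≡ + 1) ⇔ (F^ l X Y ≡ - (+ 1))
F^-swap≡1⇔F^≡-1 l X Y = mk⇔
  (λ F′≡1 → neg-injective (trans (sym (F^-swap l X Y)) F′≡1))
  (λ F≡-1 → trans (F^-swap l X Y) (cong -_ F≡-1))

∃<-cong : ∀ {p q} {P : ℕ → Set p} {Q : ℕ → Set q} {n} →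
          (∀ l → P l ⇔ Q l) → (∃[ l ] (l < n × P l)) ⇔ (∃[ l ] (l < n × Q l))
∃<-cong P⇔Q = mk⇔ (map₂ (λ {l} → map₂ (Equivalence.to (P⇔Q l))))
                  (map₂ (λ {l} → map₂ (Equivalence.from (P⇔Q l))))

F-neg⇔ : ∀ {n} (X Y : Vector Bool n) → (F X Y <ℤ 0ℤ) ⇔ (∃[ l ] (l < n × F^ l X Y ≡ - (+ 1)))
F-neg⇔ X Y = ⇔-trans (F<0⇔F-swap>0 X Y)
            (⇔-trans (F-pos⇔ Y X) (∃<-cong (λ l → F^-swap≡1⇔F^≡-1 l X Y)))

lemma5 : (n : ℕ) → n ≥ 1 → (X Y : Vector Bool n) →
         ((0ℤ <ℤ F X Y) ⇔ (∃[ l ] (l < n × F^ l X Y ≡ + 1)))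
         × ((F X Y <ℤ 0ℤ) ⇔ (∃[ l ] (l < n × F^ l X Y ≡ - (+ 1))))
lemma5 _ _ X Y = F-pos⇔ X Y , F-neg⇔ X Y
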